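{- Let $k \ge 2$ be an integer. For every positive integer $n$ with $k \mid n$ and every positive integer $d$ satisfying $$d \le \frac{(n-k+2)(n-k+1)}{e k^2 (k-1)^2 n} + 1,$$ there exists a $d$-regular linear $k$-graph on $n$ vertices.
   Context: A $k$-graph is a family of $k$-element subsets (edges) of a finite vertex set. It is $d$-regular if every vertex lies in exactly $d$ edges, and linear if every two distinct edges share at most one vertex. Here $e$ is Euler's number. -}

module Defs where

open import Data.Nat using (ℕ; zero; suc; _+_; _*_; _∸_; _^_; _≤_; _!; _/_)
open import Data.Nat.Properties using (_!≢0)
open import Data.Nat.ListAction using (sum)
open import Data.List using (List; map; upTo; length; filter)
open import Data.List.Relation.Unary.All using (All)
open import Data.List.Relation.Unary.Unique.Propositional using (Unique)
open import Data.List.Membership.Propositional using (_∈_)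
open import Data.Fin using (Fin)
open import Data.Fin.Subset using (Subset; ∣_∣; _∩_)
open import Data.Fin.Subset.Properties using (_∈?_)
open import Relation.Binary.PropositionalEquality using (_≡_; _≢_)

IsKGraph : (k n : ℕ) → List (Subset n) → Set
IsKGraph k n E = Unique E × All (λ e → ∣ e ∣ ≡ k) E
  where open import Data.Product using (_×_)

degree : ∀ {n} → List (Subset n) → Fin n → ℕ
degree E v = length (filter (v ∈?_) E)

IsRegular : ∀ {n} → ℕ → List (Subset n) → Set
IsRegular {n} d E = (v : Fin n) → degree E v ≡ d

IsLinear : ∀ {n} → List (Subset n) → Set
IsLinear E = ∀ {e f} → e ∈ E → f ∈ E → e ≢ f → ∣ e ∩ f ∣ ≤ 1

-- m! * (Σ_{i=0}^{m} 1/i!) = Σ_{i=0}^{m} m!/i!  (exact natural number),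
-- the scaled m-th partial sum of the series e = Σ 1/i!.
eNum : ℕ → ℕ
eNum m = sum (map (λ i → _/_ (m !) (i !) {{i !≢0}}) (upTo (suc m)))

-- "x * e ≤ y" for naturals x, y, with e = sup_m Σ_{i≤m} 1/i!:
-- for every m, x * (Σ_{i≤m} 1/i!) ≤ y, i.e. x * eNum m ≤ y * m!.
TimesE≤ : ℕ → ℕ → Set
TimesE≤ x y = (m : ℕ) → x * eNum m ≤ y * (m !)

-- Write n = k q and take the vertex set Fin k × ℤ_q.  For a slope a < d and an
-- intercept x ∈ ℤ_q, the edge of the line (a , x) is { (i , x + a i mod q) | i < k }.
-- Every vertex (i , y) lies on exactly one line of each slope, so the edges are
-- d-regular.  Two distinct lines (a , x), (a' , x') meeting at two points i ≠ j
-- would give q ∣ (a − a')(i − j), impossible since a ≠ a' (lines of equal slope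
-- are disjoint) and 0 < |a − a'| |i − j| ≤ (d − 1)(k − 1) < q; the last inequality
-- already follows from the hypothesis with e replaced by 2.
module Submission where

open import Data.Empty using (⊥; ⊥-elim)
open import Data.Fin using (Fin; zero; suc; toℕ; combine; remQuot)
open import Data.Fin.Properties using (toℕ-fromℕ<; toℕ-injective; toℕ<n; combine-remQuot)
  renaming (_≟_ to _≟ᶠ_; 0≢1+n to zero≢suc; suc-injective to suc-injectiveᶠ)
open import Data.Fin.Subset using (Subset; ∣_∣; _∩_; ⁅_⁆; _∈_; inside; outside; _⊆_)
open import Data.Fin.Subset.Properties
  using (nonempty?; Empty-unique; ∣⊥∣≡0; p⊆q⇒∣p∣≤∣q∣; ∣⁅x⁆∣≡1; x∈⁅x⁆; x∈⁅y⁆⇒x≡y;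
         x∈p∩q⁻; ∩-idem; _∈?_)
open import Data.List using (List; []; _∷_; _++_; tabulate; filter; length)
open import Data.List.Properties using (filter-accept; filter-reject; filter-none; filter-++; length-++)
open import Data.List.Membership.Propositional.Properties using (∈-++⁻; ∈-tabulate⁻)
import Data.List.Membership.Propositional as List
import Data.List.Relation.Unary.All as All
open import Data.List.Relation.Unary.All.Properties using (tabulate⁺)
open import Data.List.Relation.Unary.AllPairs using ([])
open import Data.List.Relation.Unary.Unique.Propositional using (Unique)
open import Data.List.Relation.Unary.Unique.Propositional.Properties using (++⁺)
  renaming (tabulate⁺ to unique-tabulate⁺)
open import Data.Nat
open import Data.Nat.DivMod
open import Data.Nat.Divisibility using (_∣_; divides; m%n≡0⇒n∣m; >⇒∤)
open import Data.Nat.Properties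
open import Data.Nat.Tactic.RingSolver using (solve-∀)
open import Data.Product using (Σ; ∃; ∃₂; _×_; _,_; proj₁; proj₂; uncurry)
open import Data.Product.Properties using (≡-dec)
open import Data.Sum using (inj₁; inj₂)
open import Data.Vec using (lookup; concat)
import Data.Vec as Vec
open import Data.Vec.Properties using (lookup-concat; lookup∘tabulate; []=⇒lookup; lookup⇒[]=)
open import Function using (_∘_)
open import Relation.Binary using (tri<; tri≈; tri>)
open import Relation.Binary.PropositionalEquality
open import Relation.Nullary using (¬_; yes; no)
open import Relation.Unary using (Pred; Decidable)

open import Defs

module _ (q : ℕ) .{{_ : NonZero q}} where
  open ≡-Reasoning

  +-cong-% : ∀ {m n} o → m % q ≡ n % q → (m + o) % q ≡ (n + o) % q
  +-cong-% {m} {n} o m≡n = begin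
    (m + o) % q          ≡⟨ %-distribˡ-+ m o q ⟩
    (m % q + o % q) % q  ≡⟨ cong (λ r → (r + o % q) % q) m≡n ⟩
    (n % q + o % q) % q  ≡⟨ %-distribˡ-+ n o q ⟨
    (n + o) % q          ∎

  o+[q∸o%q]≡[1+o/q]*q : ∀ o → o + (q ∸ o % q) ≡ suc (o / q) * q
  o+[q∸o%q]≡[1+o/q]*q o = begin
    o + (q ∸ o % q)                  ≡⟨ cong (_+ (q ∸ o % q)) (m≡m%n+[m/n]*n o q) ⟩
    o % q + o / q * q + (q ∸ o % q)  ≡⟨ +-assoc (o % q) _ _ ⟩
    o % q + (o / q * q + (q ∸ o % q)) ≡⟨ cong (o % q +_) (+-comm (o / q * q) _) ⟩
    o % q + ((q ∸ o % q) + o / q * q) ≡⟨ +-assoc (o % q) _ _ ⟨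
    o % q + (q ∸ o % q) + o / q * q  ≡⟨ cong (_+ o / q * q) (m+[n∸m]≡n (m%n≤n o q)) ⟩
    q + o / q * q                    ∎

  [m+o+[q∸o%q]]%q≡m%q : ∀ m o → (m + o + (q ∸ o % q)) % q ≡ m % q
  [m+o+[q∸o%q]]%q≡m%q m o = begin
    (m + o + (q ∸ o % q)) % q    ≡⟨ cong (_% q) (+-assoc m o _) ⟩
    (m + (o + (q ∸ o % q))) % q  ≡⟨ cong (λ r → (m + r) % q) (o+[q∸o%q]≡[1+o/q]*q o) ⟩
    (m + suc (o / q) * q) % q    ≡⟨ [m+kn]%n≡m%n m (suc (o / q)) q ⟩
    m % q                        ∎

  +-cancelʳ-% : ∀ {m n} o → (m + o) % q ≡ (n + o) % q → m % q ≡ n % q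
  +-cancelʳ-% {m} {n} o m+o≡n+o = begin
    m % q                      ≡⟨ [m+o+[q∸o%q]]%q≡m%q m o ⟨
    (m + o + (q ∸ o % q)) % q  ≡⟨ +-cong-% (q ∸ o % q) m+o≡n+o ⟩
    (n + o + (q ∸ o % q)) % q  ≡⟨ [m+o+[q∸o%q]]%q≡m%q n o ⟩
    n % q                      ∎

  -- From j to i the difference of the two sides grows by (a − a')(i − j).
  agree-twice⇒∣ : ∀ {x x' a a' j i} → a' ≤ a → j ≤ i →
                  (x + a * j) % q ≡ (x' + a' * j) % q →
                  (x + a * i) % q ≡ (x' + a' * i) % q →
                  q ∣ (a ∸ a') * (i ∸ j)
  agree-twice⇒∣ {x} {x'} {a} {a'} {j} {i} a'≤a j≤i at-j at-i
    with D , refl ← m≤n⇒∃[o]m+o≡n a'≤a | T , refl ← m≤n⇒∃[o]m+o≡n j≤i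
    rewrite m+n∸m≡n a' D | m+n∸m≡n j T =
      m%n≡0⇒n∣m (D * T) q (trans (+-cancelʳ-% s DT+s≡s) (m<n⇒m%n≡m (>-nonZero⁻¹ q)))
    where
    s = x + (a' + D) * j + a' * T
    DT+s≡s : (D * T + s) % q ≡ (0 + s) % q
    DT+s≡s = begin
      (D * T + s) % q                    ≡⟨ cong (_% q) (split-lhs x a' D j T) ⟨
      (x + (a' + D) * (j + T)) % q       ≡⟨ at-i ⟩
      (x' + a' * (j + T)) % q            ≡⟨ cong (_% q) (split-rhs x' a' j T) ⟩
      (x' + a' * j + a' * T) % q         ≡⟨ +-cong-% (a' * T) at-j ⟨
      s % q                              ∎
      where
      split-lhs : ∀ x a' D j T → x + (a' + D) * (j + T) ≡ D * T + (x + (a' + D) * j + a' * T)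
      split-lhs = solve-∀
      split-rhs : ∀ x' a' j T → x' + a' * (j + T) ≡ x' + a' * j + a' * T
      split-rhs = solve-∀

  shift : ℕ → Fin q → Fin q
  shift c x = (toℕ x + c) mod q

  toℕ-shift : ∀ c x → toℕ (shift c x) ≡ (toℕ x + c) % q
  toℕ-shift c x = toℕ-fromℕ< (m%n<n (toℕ x + c) q)

  shift≡⇒%≡ : ∀ c x c' x' → shift c x ≡ shift c' x' → (toℕ x + c) % q ≡ (toℕ x' + c') % q
  shift≡⇒%≡ c x c' x' eq = trans (sym (toℕ-shift c x)) (trans (cong toℕ eq) (toℕ-shift c' x'))

  shift-injective : ∀ c {x x'} → shift c x ≡ shift c x' → x ≡ x'
  shift-injective c {x} {x'} eq = toℕ-injective (begin
    toℕ x       ≡⟨ m<n⇒m%n≡m (toℕ<n x) ⟨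
    toℕ x % q   ≡⟨ +-cancelʳ-% c (shift≡⇒%≡ c x c x' eq) ⟩
    toℕ x' % q  ≡⟨ m<n⇒m%n≡m (toℕ<n x') ⟩
    toℕ x'      ∎)

  shift-surjective : ∀ c y → ∃ λ x → shift c x ≡ y
  shift-surjective c y = x , toℕ-injective (begin
    toℕ (shift c x)                      ≡⟨ toℕ-shift c x ⟩
    (toℕ x + c) % q                      ≡⟨ +-cong-% c (trans (cong (_% q) (toℕ-fromℕ< _)) (m%n%n≡m%n _ q)) ⟩
    (toℕ y + (q ∸ c % q) + c) % q        ≡⟨ cong (_% q) (+-assoc (toℕ y) _ c) ⟩
    (toℕ y + ((q ∸ c % q) + c)) % q      ≡⟨ cong (λ r → (toℕ y + r) % q) (+-comm _ c) ⟩
    (toℕ y + (c + (q ∸ c % q))) % q      ≡⟨ cong (_% q) (+-assoc (toℕ y) c _) ⟨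
    (toℕ y + c + (q ∸ c % q)) % q        ≡⟨ [m+o+[q∸o%q]]%q≡m%q (toℕ y) c ⟩
    toℕ y % q                            ≡⟨ m<n⇒m%n≡m (toℕ<n y) ⟩
    toℕ y                                ∎)
    where
    x = (toℕ y + (q ∸ c % q)) mod q

subsingleton⇒∣p∣≤1 : ∀ {n} (p : Subset n) → (∀ {x y} → x ∈ p → y ∈ p → x ≡ y) → ∣ p ∣ ≤ 1
subsingleton⇒∣p∣≤1 {n} p all-equal with nonempty? p
... | no empty = subst (_≤ 1) (sym (trans (cong ∣_∣ (Empty-unique empty)) (∣⊥∣≡0 n))) z≤n
... | yes (x , x∈p) = ≤-trans (p⊆q⇒∣p∣≤∣q∣ p⊆⁅x⁆) (≤-reflexive (∣⁅x⁆∣≡1 x))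
  where
  p⊆⁅x⁆ : p ⊆ ⁅ x ⁆
  p⊆⁅x⁆ y∈p = subst (_∈ ⁅ x ⁆) (all-equal x∈p y∈p) (x∈⁅x⁆ x)

∣p++q∣≡∣p∣+∣q∣ : ∀ {m n} (p : Subset m) (r : Subset n) → ∣ p Vec.++ r ∣ ≡ ∣ p ∣ + ∣ r ∣
∣p++q∣≡∣p∣+∣q∣ Vec.[] r = refl
∣p++q∣≡∣p∣+∣q∣ (inside Vec.∷ p) r = cong suc (∣p++q∣≡∣p∣+∣q∣ p r)
∣p++q∣≡∣p∣+∣q∣ (outside Vec.∷ p) r = ∣p++q∣≡∣p∣+∣q∣ p r

-- The graph { (i , f i) } of f, as a subset of Fin k × Fin q ≅ Fin (k * q).
transversal : ∀ {k q} → (Fin k → Fin q) → Subset (k * q)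
transversal f = concat (Vec.tabulate (λ i → ⁅ f i ⁆))

∣transversal∣≡k : ∀ {k q} (f : Fin k → Fin q) → ∣ transversal f ∣ ≡ k
∣transversal∣≡k {zero} f = refl
∣transversal∣≡k {suc k} f = trans (∣p++q∣≡∣p∣+∣q∣ ⁅ f zero ⁆ _)
  (cong₂ _+_ (∣⁅x⁆∣≡1 (f zero)) (∣transversal∣≡k (f ∘ suc)))

module _ {k q} (f : Fin k → Fin q) (i : Fin k) {y : Fin q} where

  lookup-transversal : lookup (transversal f) (combine i y) ≡ lookup ⁅ f i ⁆ y
  lookup-transversal = trans (lookup-concat (Vec.tabulate (λ i → ⁅ f i ⁆)) i y)
    (cong (λ r → lookup r y) (lookup∘tabulate (λ i → ⁅ f i ⁆) i))

  ∈-transversal⁻ : combine i y ∈ transversal f → y ≡ f i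
  ∈-transversal⁻ y∈f = x∈⁅y⁆⇒x≡y (f i) (lookup⇒[]= y ⁅ f i ⁆ (trans (sym lookup-transversal) ([]=⇒lookup y∈f)))

  ∈-transversal⁺ : y ≡ f i → combine i y ∈ transversal f
  ∈-transversal⁺ refl = lookup⇒[]= (combine i y) (transversal f)
    (trans lookup-transversal ([]=⇒lookup (x∈⁅x⁆ (f i))))

AgreeAtMostOnce : ∀ {k q} → (f g : Fin k → Fin q) → Set
AgreeAtMostOnce f g = ∀ {i j} → f i ≡ g i → f j ≡ g j → i ≡ j

∣transversal∩transversal∣≤1 : ∀ {k q} {f g : Fin k → Fin q} → AgreeAtMostOnce f g →
                              ∣ transversal f ∩ transversal g ∣ ≤ 1
∣transversal∩transversal∣≤1 {k} {q} {f} {g} once = subsingleton⇒∣p∣≤1 _ λ {u} {v} u∈ v∈ → begin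
  u                                  ≡⟨ combine-remQuot {k} q u ⟨
  uncurry combine (remQuot {k} q u)  ≡⟨ cong (uncurry combine) (same-coordinates u∈ v∈) ⟩
  uncurry combine (remQuot {k} q v)  ≡⟨ combine-remQuot {k} q v ⟩
  v                                  ∎
  where
  open ≡-Reasoning

  on-graph : ∀ h {u} → u ∈ transversal h → proj₂ (remQuot {k} q u) ≡ h (proj₁ (remQuot {k} q u))
  on-graph h {u} u∈h = ∈-transversal⁻ h _ (subst (_∈ transversal h) (sym (combine-remQuot {k} q u)) u∈h)

  same-coordinates : ∀ {u v} → u ∈ transversal f ∩ transversal g → v ∈ transversal f ∩ transversal g →
                     remQuot {k} q u ≡ remQuot {k} q v
  same-coordinates u∈ v∈
    with u∈f , u∈g ← x∈p∩q⁻ (transversal f) (transversal g) u∈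
       | v∈f , v∈g ← x∈p∩q⁻ (transversal f) (transversal g) v∈ =
    cong₂ _,_ i≡j (trans (on-graph f u∈f) (trans (cong f i≡j) (sym (on-graph f v∈f))))
    where
    i≡j = once (trans (sym (on-graph f u∈f)) (on-graph g u∈g)) (trans (sym (on-graph f v∈f)) (on-graph g v∈g))

length-filter-tabulate≡1 : ∀ {a p} {A : Set a} {P : Pred A p} (P? : Decidable P) {n} (f : Fin n → A) {i₀} →
                           P (f i₀) → (∀ {i} → P (f i) → i ≡ i₀) → length (filter P? (tabulate f)) ≡ 1
length-filter-tabulate≡1 P? f {zero} P₀ only = cong length (trans (filter-accept P? P₀)
  (cong (f zero ∷_) (filter-none P? (tabulate⁺ {f = f ∘ suc} λ i Pi → zero≢suc (sym (only Pi))))))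
length-filter-tabulate≡1 P? f {suc i₀} P₀ only = trans (cong length (filter-reject P? (λ P0 → zero≢suc (only P0))))
  (length-filter-tabulate≡1 P? (f ∘ suc) P₀ (λ {i} Pi → suc-injectiveᶠ (only {suc i} Pi)))

LinearRegularKGraph : ℕ → ℕ → ℕ → Set
LinearRegularKGraph k d n = Σ (List (Subset n)) λ E → IsKGraph k n E × IsRegular d E × IsLinear E

module AffineLines (k q d : ℕ) .{{_ : NonZero q}} (2≤k : 2 ≤ k) (small : (d ∸ 1) * (k ∸ 1) < q) where

  line : ℕ → Fin q → Fin k → Fin q
  line a x i = shift q (a * toℕ i) x

  edge : ℕ → Fin q → Subset (k * q)
  edge a x = transversal (line a x)

  edges : ℕ → List (Subset (k * q))
  edges zero = []
  edges (suc a) = tabulate (edge a) ++ edges a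

  steeper-line-meets-once : ∀ {a a' x x'} {i j : Fin k} → a' < a → a < d → toℕ j < toℕ i →
                            line a x j ≡ line a' x' j → line a x i ≡ line a' x' i → ⊥
  steeper-line-meets-once {a} {a'} {x} {x'} {i} {j} a'<a a<d j<i at-j at-i =
    >⇒∤ {{>-nonZero (*-mono-≤ (m<n⇒0<n∸m a'<a) (m<n⇒0<n∸m j<i))}} product<q
      (agree-twice⇒∣ q (<⇒≤ a'<a) (<⇒≤ j<i) (shift≡⇒%≡ q _ x _ x' at-j) (shift≡⇒%≡ q _ x _ x' at-i))
    where
    product<q : (a ∸ a') * (toℕ i ∸ toℕ j) < q
    product<q = ≤-<-trans (*-mono-≤ (≤-trans (m∸n≤m a a') (∸-monoˡ-≤ 1 a<d))
                                    (≤-trans (m∸n≤m (toℕ i) (toℕ j)) (∸-monoˡ-≤ 1 (toℕ<n i))))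
                          small

  steeper-line-agrees-at-most-once : ∀ {a a' x x'} → a' < a → a < d → AgreeAtMostOnce (line a x) (line a' x')
  steeper-line-agrees-at-most-once a'<a a<d {i} {j} at-i at-j with <-cmp (toℕ i) (toℕ j)
  ... | tri< i<j _ _ = ⊥-elim (steeper-line-meets-once a'<a a<d i<j at-i at-j)
  ... | tri≈ _ i≡j _ = toℕ-injective i≡j
  ... | tri> _ _ j<i = ⊥-elim (steeper-line-meets-once a'<a a<d j<i at-j at-i)

  lines-agree-at-most-once : ∀ {a a' x x'} → a < d → a' < d → (a , x) ≢ (a' , x') →
                             AgreeAtMostOnce (line a x) (line a' x')
  lines-agree-at-most-once {a} {a'} a<d a'<d distinct at-i at-j with <-cmp a a'
  ... | tri< a<a' _ _ = steeper-line-agrees-at-most-once a<a' a'<d (sym at-i) (sym at-j)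
  ... | tri≈ _ refl _ = ⊥-elim (distinct (cong (a ,_) (shift-injective q _ at-i)))
  ... | tri> _ _ a'<a = steeper-line-agrees-at-most-once a'<a a<d at-i at-j

  edges-meet-at-most-once : ∀ {a a' x x'} → a < d → a' < d → (a , x) ≢ (a' , x') →
                            ∣ edge a x ∩ edge a' x' ∣ ≤ 1
  edges-meet-at-most-once a<d a'<d distinct =
    ∣transversal∩transversal∣≤1 (lines-agree-at-most-once a<d a'<d distinct)

  edge-injective : ∀ {a a' x x'} → a < d → a' < d → edge a x ≡ edge a' x' → (a , x) ≡ (a' , x')
  edge-injective {a} {a'} {x} {x'} a<d a'<d same with ≡-dec _≟_ _≟ᶠ_ (a , x) (a' , x')
  ... | yes same-line = same-line
  ... | no distinct = ⊥-elim (<⇒≱ 2≤k (begin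
    k                          ≡⟨ ∣transversal∣≡k (line a x) ⟨
    ∣ edge a x ∣               ≡⟨ cong ∣_∣ (∩-idem (edge a x)) ⟨
    ∣ edge a x ∩ edge a x ∣    ≡⟨ cong (λ e → ∣ edge a x ∩ e ∣) same ⟩
    ∣ edge a x ∩ edge a' x' ∣  ≤⟨ edges-meet-at-most-once a<d a'<d distinct ⟩
    1                          ∎))
    where open ≤-Reasoning

  ∈-edges⁻ : ∀ a {e} → e List.∈ edges a → ∃₂ λ b x → b < a × e ≡ edge b x
  ∈-edges⁻ (suc a) e∈ with ∈-++⁻ (tabulate (edge a)) e∈
  ... | inj₁ e∈slope = let x , e≡ = ∈-tabulate⁻ e∈slope in a , x , n<1+n a , e≡
  ... | inj₂ e∈rest = let b , x , b<a , e≡ = ∈-edges⁻ a e∈rest in b , x , m≤n⇒m≤1+n b<a , e≡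

  edges-unique : ∀ {a} → a ≤ d → Unique (edges a)
  edges-unique {zero} _ = []
  edges-unique {suc a} a<d =
    ++⁺ (unique-tabulate⁺ (cong proj₂ ∘ edge-injective a<d a<d)) (edges-unique (<⇒≤ a<d)) disjoint
    where
    disjoint : ∀ {e} → ¬ (e List.∈ tabulate (edge a) × e List.∈ edges a)
    disjoint (e∈slope , e∈rest) with ∈-tabulate⁻ e∈slope | ∈-edges⁻ a e∈rest
    ... | x , refl | b , x' , b<a , same =
      <⇒≢ b<a (sym (cong proj₁ (edge-injective a<d (<-trans b<a a<d) same)))

  degree-slope : ∀ (i : Fin k) (y : Fin q) a → degree (tabulate (edge a)) (combine i y) ≡ 1
  degree-slope i y a = length-filter-tabulate≡1 (combine i y ∈?_) (edge a)
    (∈-transversal⁺ (line a _) i (sym hits))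
    (λ {x} y∈ → shift-injective q _ (trans (sym (∈-transversal⁻ (line a x) i y∈)) (sym hits)))
    where
    x₀,hits = shift-surjective q (a * toℕ i) y
    hits : shift q (a * toℕ i) (proj₁ x₀,hits) ≡ y
    hits = proj₂ x₀,hits

  degree-edges : ∀ (i : Fin k) (y : Fin q) a → degree (edges a) (combine i y) ≡ a
  degree-edges i y zero = refl
  degree-edges i y (suc a) = begin
    length (filter P? (tabulate (edge a) ++ edges a))
      ≡⟨ cong length (filter-++ P? (tabulate (edge a)) (edges a)) ⟩
    length (filter P? (tabulate (edge a)) ++ filter P? (edges a))
      ≡⟨ length-++ (filter P? (tabulate (edge a))) ⟩
    degree (tabulate (edge a)) (combine i y) + degree (edges a) (combine i y)
      ≡⟨ cong₂ _+_ (degree-slope i y a) (degree-edges i y a) ⟩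
    suc a ∎
    where
    open ≡-Reasoning
    P? = combine i y ∈?_

  linear-regular : LinearRegularKGraph k d (k * q)
  linear-regular = edges d , (edges-unique ≤-refl , All.tabulate size) , regular , linear
    where
    size : ∀ {e} → e List.∈ edges d → ∣ e ∣ ≡ k
    size e∈ with ∈-edges⁻ d e∈
    ... | b , x , _ , refl = ∣transversal∣≡k (line b x)

    regular : IsRegular d (edges d)
    regular v = subst (λ w → degree (edges d) w ≡ d) (combine-remQuot {k} q v)
      (degree-edges (proj₁ (remQuot {k} q v)) (proj₂ (remQuot {k} q v)) d)

    linear : IsLinear (edges d)
    linear e∈ f∈ e≢f with ∈-edges⁻ d e∈ | ∈-edges⁻ d f∈
    ... | b , x , b<d , refl | b' , x' , b'<d , refl =
      edges-meet-at-most-once b<d b'<d (e≢f ∘ cong (uncurry edge))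

*2≤⇒< : ∀ {m n} → 0 < n → m * 2 ≤ n → m < n
*2≤⇒< {zero} 0<n _ = 0<n
*2≤⇒< {suc m} _ m*2≤n = <-≤-trans (m<m*n (suc m) 2 ≤-refl) m*2≤n

slopes-bound : ∀ {k q A} .{{_ : NonZero q}} → 2 ≤ k →
               TimesE≤ (A * (k ^ 2 * (k ∸ 1) ^ 2 * (q * k))) ((q * k ∸ k + 2) * (q * k ∸ k + 1)) →
               A * (k ∸ 1) < q
slopes-bound {k} {q} {A} 2≤k x*e≤y = *2≤⇒< (>-nonZero⁻¹ q) (begin
  A * (k ∸ 1) * 2                    ≤⟨ *-monoʳ-≤ (A * (k ∸ 1)) (*-monoʳ-≤ 2 1≤k*[k∸1]) ⟩
  A * (k ∸ 1) * (2 * (k * (k ∸ 1)))  ≤⟨ *-cancelʳ-≤ _ q (k * n) scaled ⟩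
  q                                  ∎)
  where
  open ≤-Reasoning
  n = q * k
  instance
    k≢0 : NonZero k
    k≢0 = >-nonZero (<⇒≤ 2≤k)
    kn≢0 : NonZero (k * n)
    kn≢0 = m*n≢0 k n {{k≢0}} {{m*n≢0 q k}}

  1≤k*[k∸1] : 1 ≤ k * (k ∸ 1)
  1≤k*[k∸1] = *-mono-≤ (<⇒≤ 2≤k) (∸-monoˡ-≤ 1 2≤k)

  n∸k+c≤n : ∀ {c} → c ≤ k → n ∸ k + c ≤ n
  n∸k+c≤n c≤k = ≤-trans (+-monoʳ-≤ (n ∸ k) c≤k) (≤-reflexive (m∸n+n≡m (m≤n*m k q)))

  -- The partial sum 1/0! + 1/1! = 2 of e.
  x*2≤y : A * (k ^ 2 * (k ∸ 1) ^ 2 * n) * 2 ≤ (n ∸ k + 2) * (n ∸ k + 1)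
  x*2≤y = subst (A * (k ^ 2 * (k ∸ 1) ^ 2 * n) * 2 ≤_) (*-identityʳ _) (x*e≤y 1)

  -- k ^ 2 is written in its normal form k * (k * 1), which the ring solver accepts.
  rearrange : ∀ A k k' n → A * (k * (k * 1) * (k' * (k' * 1)) * n) * 2 ≡ A * k' * (2 * (k * k')) * (k * n)
  rearrange = solve-∀

  scaled : A * (k ∸ 1) * (2 * (k * (k ∸ 1))) * (k * n) ≤ q * (k * n)
  scaled = begin
    A * (k ∸ 1) * (2 * (k * (k ∸ 1))) * (k * n)  ≡⟨ rearrange A k (k ∸ 1) n ⟨
    A * (k ^ 2 * (k ∸ 1) ^ 2 * n) * 2           ≤⟨ x*2≤y ⟩
    (n ∸ k + 2) * (n ∸ k + 1)                   ≤⟨ *-mono-≤ (n∸k+c≤n 2≤k) (n∸k+c≤n (<⇒≤ 2≤k)) ⟩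
    n * n                                       ≡⟨ *-assoc q k n ⟩
    q * (k * n)                                 ∎

lemma2p5 : (k : ℕ) → 2 ≤ k → (n : ℕ) → 1 ≤ n → k ∣ n → (d : ℕ) → 1 ≤ d →
    TimesE≤ ((d ∸ 1) * (k ^ 2 * (k ∸ 1) ^ 2 * n)) ((n ∸ k + 2) * (n ∸ k + 1)) →
    Σ (List (Subset n)) (λ E → IsKGraph k n E × IsRegular d E × IsLinear E)
lemma2p5 k 2≤k .(0 * k) () (divides zero refl) d _ _
lemma2p5 k 2≤k .(q * k) _ (divides q@(suc _) refl) d _ x*e≤y =
  subst (LinearRegularKGraph k d) (*-comm k q)
    (AffineLines.linear-regular k q d 2≤k (slopes-bound {A = d ∸ 1} 2≤k x*e≤y))
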